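{- Let $b\ge 2$, $m\ge1$ be integers, $\Sigma$ an alphabet with $m$ letters, $\sigma$ a cyclic permutation of $\Sigma$ (a single $m$-cycle), $\overline{\alpha}\in\Sigma$, and suppose the corresponding generalized Thue–Morse word $\mathbf{t}$ is aperiodic. Let $w$ be a factor of $\mathbf{t}$ of length $\ell$ with $b\nmid\ell$. Then $\textsc{Index}(w)\le 2b/m$ if $b>m$, and $\textsc{Index}(w)\le 2$ if $b\le m$.
   Context: $\mu(\alpha)=\alpha\,\sigma(\alpha)\cdots\sigma^{b-1}(\alpha)$, $\mathbf{t}=\lim_n\mu^n(\overline{\alpha})$. Aperiodic means not ultimately periodic. For a nonempty word $w$ and rational $r>0$ with $r|w|\in\mathbb N$, $w^r=w^{\lfloor r\rfloor}p$ with $p$ the prefix of $w$ of length $(r-\lfloor r\rfloor)|w|$; $\textsc{Index}(w)=\max\{r\in\mathbb Q: w^r\text{ is a factor of }\mathbf{t}\}$ (or $\infty$ if no maximum exists). -}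

module Defs where

open import Data.Nat using (ℕ; zero; suc; _+_; _*_; _<_; _≤_; _^_; NonZero)
open import Data.Nat.DivMod using (_/_; _%_)
open import Data.Fin using (Fin)
open import Data.List using (List; []; _∷_; _++_; concat; concatMap; replicate; take; length)
open import Data.Product using (∃; Σ; _×_; _,_)
open import Relation.Binary.PropositionalEquality using (_≡_)
open import Relation.Nullary using (¬_)

iter : {A : Set} → (A → A) → ℕ → A → A
iter f zero    x = x
iter f (suc k) x = f (iter f k x)

IsCyclicPerm : (m : ℕ) → (Fin m → Fin m) → Set
IsCyclicPerm m σ =
  (∀ x y → σ x ≡ σ y → x ≡ y) ×
  (∀ y → ∃ λ x → σ x ≡ y) ×
  (∀ x y → ∃ λ k → iter σ k x ≡ y)

μ : {m : ℕ} → ℕ → (Fin m → Fin m) → Fin m → List (Fin m)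
μ {m} b σ α = go b α
  where
  go : ℕ → Fin m → List (Fin m)
  go zero    a = []
  go (suc k) a = a ∷ go k (σ a)

μ* : {m : ℕ} → ℕ → (Fin m → Fin m) → List (Fin m) → List (Fin m)
μ* b σ = concatMap (μ b σ)

nth : {A : Set} → List A → ℕ → A → A
nth []       _       d = d
nth (x ∷ xs) zero    d = x
nth (x ∷ xs) (suc n) d = nth xs n d

-- The generalized Thue–Morse word t = lim_n μ^n(ᾱ), as an infinite word ℕ → Fin m.
-- Since μ(ᾱ) begins with ᾱ, μ^n(ᾱ) is a prefix of μ^{n+1}(ᾱ); for b ≥ 2 the word
-- μ^{i+1}(ᾱ) has length b^{i+1} > i, so position i of the limit is position i of μ^{i+1}(ᾱ).
tm : {m : ℕ} → ℕ → (Fin m → Fin m) → Fin m → ℕ → Fin m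
tm b σ a i = nth (iter (μ* b σ) (suc i) (a ∷ [])) i a

UltPeriodic : {A : Set} → (ℕ → A) → Set
UltPeriodic t = Σ ℕ λ p → Σ ℕ λ N → (0 < p) × (∀ n → N ≤ n → t (n + p) ≡ t n)

Aperiodic : {A : Set} → (ℕ → A) → Set
Aperiodic t = ¬ UltPeriodic t

Factor : {A : Set} → List A → (ℕ → A) → Set
Factor w t = Σ ℕ λ i → ∀ j → (j<n : j < length w) → t (i + j) ≡ Data.List.lookup w (Data.Fin.fromℕ< j<n)

-- Fractional power w^r with r = L / |w| (so L = r|w|):
-- w^r = w^{⌊r⌋} p, p the prefix of w of length (r - ⌊r⌋)|w| = L mod |w|.
pow : {A : Set} → (w : List A) → .{{NonZero (length w)}} → ℕ → List A
pow w L = concat (replicate (L / length w) w) ++ take (L % length w) w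

-- Since μ(α) = α σ(α) ⋯ σ^(b-1)(α), the word t satisfies t(X b + j) = σ^j (t X) for j < b.
-- Write ℓ = q b + r with 0 < r < b and s = b - r, and split block B (positions B b, …, B b + b - 1)
-- into a head of length s and a tail of length r. Period ℓ at a head position of block B gives
-- σ^r (t (B + q)) = t B, at a tail position t (B + q + 1) = σ^s (t B). A tail relation for B together
-- with a head relation for B + 1, or a head and a tail relation for the same B, yield t(x + 1) = σ^b (t x).
-- This forces b ∣ x + 1: otherwise σ^(b-1) fixes a letter, hence is the identity, and t is periodic.
-- A run of period ℓ long enough to give this for two consecutive x cannot exist, which bounds the
-- length of the run; when q = 0 and r < m a single head relation already contradicts σ being an
-- m-cycle, since then σ^r fixes a letter.
module Submission where

open import Defs
open import Data.Nat
  using (ℕ; zero; suc; _+_; _*_; _^_; _∸_; _⊔_; _<_; _≤_; _≤′_; ≤′-refl; ≤′-step; NonZero; >-nonZero; z≤n; z<s; s≤s; s≤s⁻¹)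
open import Data.Nat.Properties
open import Data.Nat.DivMod using (_/_; _%_; m≡m%n+[m/n]*n; m%n<n; m%n≤n)
open import Data.Nat.Divisibility using (_∣_; divides; ∣1⇒≡1; ∣m+n∣m⇒∣n)
open import Data.Nat.Induction using (<-rec)
open import Data.Nat.Tactic.RingSolver using (solve-∀)
open import Data.Fin using (Fin; toℕ; fromℕ<)
import Data.Fin.Properties as Fin
open import Data.List using (List; []; _∷_; _++_; length; concat; map; replicate; take; drop; lookup)
open import Data.List.Properties
  using (length-++; length-++-≤ˡ; length-take; concat-++; map-++; ++-assoc; ++-monoid; take++drop≡id)
open import Data.Product using (∃; ∃₂; _×_; _,_; proj₁; proj₂)
open import Data.Sum using (_⊎_; inj₁; inj₂)
open import Data.Empty using (⊥)
open import Relation.Binary.PropositionalEquality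
open import Function using (_∘_)
open import Relation.Nullary using (¬_; yes; no; contradiction)

import Algebra.Properties.Monoid.Divisibility
open module ListPrefix {A : Set} = Algebra.Properties.Monoid.Divisibility (++-monoid A)
  using (_∣ˡ_; _,_; ∣ˡ-refl; ∣ˡ-trans; x∣ˡy⇒x∣ˡyz; x∣ˡy⇒zx∣ˡzy)


module _ {A : Set} (f : A → A) where

  iter-+ : ∀ i j x → iter f (i + j) x ≡ iter f i (iter f j x)
  iter-+ zero    j x = refl
  iter-+ (suc i) j x = cong f (iter-+ i j x)

  iter-comm : ∀ i j x → iter f i (iter f j x) ≡ iter f j (iter f i x)
  iter-comm i j x = begin
    iter f i (iter f j x) ≡⟨ iter-+ i j x ⟨
    iter f (i + j) x      ≡⟨ cong (λ k → iter f k x) (+-comm i j) ⟩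
    iter f (j + i) x      ≡⟨ iter-+ j i x ⟩
    iter f j (iter f i x) ∎
    where open ≡-Reasoning

  iter-sucʳ : ∀ i x → iter f (suc i) x ≡ iter f i (f x)
  iter-sucʳ i x = trans (cong (λ k → iter f k x) (+-comm 1 i)) (iter-+ i 1 x)

  iter-injective : (∀ {x y} → f x ≡ f y → x ≡ y) → ∀ i {x y} → iter f i x ≡ iter f i y → x ≡ y
  iter-injective inj zero    eq = eq
  iter-injective inj (suc i) eq = iter-injective inj i (inj eq)

  iter-*-identity : ∀ {n} → (∀ x → iter f n x ≡ x) → ∀ c x → iter f (c * n) x ≡ x
  iter-*-identity fⁿ≗id zero    x = refl
  iter-*-identity {n} fⁿ≗id (suc c) x =
    trans (iter-+ n (c * n) x) (trans (cong (iter f n) (iter-*-identity fⁿ≗id c x)) (fⁿ≗id x))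

module _ {A : Set} where

  nth-++ˡ : ∀ (xs ys : List A) {i} d → i < length xs → nth (xs ++ ys) i d ≡ nth xs i d
  nth-++ˡ (x ∷ xs) ys {zero}  d _         = refl
  nth-++ˡ (x ∷ xs) ys {suc i} d (s≤s i<n) = nth-++ˡ xs ys d i<n

  nth-++ʳ : ∀ (xs ys : List A) i d → nth (xs ++ ys) (length xs + i) d ≡ nth ys i d
  nth-++ʳ []       ys i d = refl
  nth-++ʳ (x ∷ xs) ys i d = nth-++ʳ xs ys i d

  nth-∣ˡ : ∀ {xs ys : List A} {i} d → xs ∣ˡ ys → i < length xs → nth xs i d ≡ nth ys i d
  nth-∣ˡ {xs} d (zs , refl) i<n = sym (nth-++ˡ xs zs d i<n)

  length-∣ˡ : ∀ {xs ys : List A} → xs ∣ˡ ys → length xs ≤ length ys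
  length-∣ˡ {xs} (zs , refl) = length-++-≤ˡ xs

  lookup-fromℕ<≡nth : ∀ (xs : List A) {i} d (i<n : i < length xs) → lookup xs (fromℕ< i<n) ≡ nth xs i d
  lookup-fromℕ<≡nth (x ∷ xs) {zero}  d _         = refl
  lookup-fromℕ<≡nth (x ∷ xs) {suc i} d (s≤s i<n) = lookup-fromℕ<≡nth xs d i<n

  length-concat-replicate : ∀ k (w : List A) → length (concat (replicate k w)) ≡ k * length w
  length-concat-replicate zero    w = refl
  length-concat-replicate (suc k) w = trans (length-++ w) (cong (length w +_) (length-concat-replicate k w))

n<b^n : ∀ {b} → 2 ≤ b → ∀ n → n < b ^ n
n<b^n 2≤b zero = s≤s z≤n
n<b^n {b} 2≤b (suc n) = begin-strict
  suc n          ≤⟨ ih ⟩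
  b ^ n          <⟨ m<m+n (b ^ n) (≤-trans (s≤s z≤n) ih) ⟩
  b ^ n + b ^ n  ≡⟨ cong (b ^ n +_) (+-identityʳ (b ^ n)) ⟨
  2 * b ^ n      ≤⟨ *-monoˡ-≤ (b ^ n) 2≤b ⟩
  b * b ^ n      ∎
  where
  open ≤-Reasoning
  ih : n < b ^ n
  ih = n<b^n 2≤b n

quotient-remainder : ∀ n d .{{_ : NonZero d}} → ∃₂ λ X j → j < d × n ≡ X * d + j
quotient-remainder n d = n / d , n % d , m%n<n n d , trans (m≡m%n+[m/n]*n n d) (+-comm (n % d) _)

X*b+j<N*b : ∀ {X N j b} → X < N → j < b → X * b + j < N * b
X*b+j<N*b {X} {N} {j} {b} X<N j<b = begin-strict
  X * b + j  <⟨ +-monoʳ-< (X * b) j<b ⟩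
  X * b + b  ≡⟨ +-comm (X * b) b ⟩
  suc X * b  ≤⟨ *-monoˡ-≤ b X<N ⟩
  N * b      ∎
  where open ≤-Reasoning

∣n∧∣1+n⇒≡1 : ∀ {d n} → d ∣ n → d ∣ suc n → d ≡ 1
∣n∧∣1+n⇒≡1 {d} {n} d∣n d∣1+n = ∣1⇒≡1 (∣m+n∣m⇒∣n (subst (d ∣_) (+-comm 1 n) d∣1+n) d∣n)

module _ {m : ℕ} (b : ℕ) (σ : Fin m → Fin m) where

  length-μ : ∀ k a → length (μ k σ a) ≡ k
  length-μ zero    a = refl
  length-μ (suc k) a = cong suc (length-μ k (σ a))

  nth-μ : ∀ k a {j} d → j < k → nth (μ k σ a) j d ≡ iter σ j a
  nth-μ (suc k) a {zero}  d _         = refl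
  nth-μ (suc k) a {suc j} d (s≤s j<k) = trans (nth-μ k (σ a) d j<k) (sym (iter-sucʳ σ j a))

  μ*-++ : ∀ xs ys → μ* b σ (xs ++ ys) ≡ μ* b σ xs ++ μ* b σ ys
  μ*-++ xs ys = trans (cong concat (map-++ (μ b σ) xs ys)) (sym (concat-++ (map (μ b σ) xs) (map (μ b σ) ys)))

  μ*-∣ˡ : ∀ {xs ys} → xs ∣ˡ ys → μ* b σ xs ∣ˡ μ* b σ ys
  μ*-∣ˡ {xs} (zs , refl) = μ* b σ zs , sym (μ*-++ xs zs)

  length-μ* : ∀ w → length (μ* b σ w) ≡ length w * b
  length-μ* []      = refl
  length-μ* (x ∷ w) = trans (length-++ (μ b σ x)) (cong₂ _+_ (length-μ b x) (length-μ* w))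

  nth-μ* : ∀ w X {j} d → X < length w → j < b → nth (μ* b σ w) (X * b + j) d ≡ iter σ j (nth w X d)
  nth-μ* (x ∷ w) zero    {j} d _ j<b =
    trans (nth-++ˡ (μ b σ x) _ d (subst (j <_) (sym (length-μ b x)) j<b)) (nth-μ b x d j<b)
  nth-μ* (x ∷ w) (suc X) {j} d (s≤s X<n) j<b = begin
    nth (μ b σ x ++ μ* b σ w) (b + X * b + j) d                   ≡⟨ cong (λ i → nth (μ b σ x ++ μ* b σ w) i d) position ⟩
    nth (μ b σ x ++ μ* b σ w) (length (μ b σ x) + (X * b + j)) d  ≡⟨ nth-++ʳ (μ b σ x) _ _ d ⟩
    nth (μ* b σ w) (X * b + j) d                                  ≡⟨ nth-μ* w X d X<n j<b ⟩
    iter σ j (nth w X d)                                          ∎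
    where
    open ≡-Reasoning
    position : b + X * b + j ≡ length (μ b σ x) + (X * b + j)
    position = trans (+-assoc b (X * b) j) (cong (_+ (X * b + j)) (sym (length-μ b x)))

  μⁿ : ℕ → Fin m → List (Fin m)
  μⁿ n a = iter (μ* b σ) n (a ∷ [])

  length-μⁿ : ∀ n a → length (μⁿ n a) ≡ b ^ n
  length-μⁿ zero    a = refl
  length-μⁿ (suc n) a = trans (length-μ* (μⁿ n a)) (trans (cong (_* b) (length-μⁿ n a)) (*-comm (b ^ n) b))

  μⁿ-∣ˡ-suc : 1 ≤ b → ∀ n a → μⁿ n a ∣ˡ μⁿ (suc n) a
  μⁿ-∣ˡ-suc (s≤s _) zero    a = _ , refl
  μⁿ-∣ˡ-suc 1≤b     (suc n) a = μ*-∣ˡ (μⁿ-∣ˡ-suc 1≤b n a)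

  μⁿ-mono : 1 ≤ b → ∀ {n n'} a → n ≤ n' → μⁿ n a ∣ˡ μⁿ n' a
  μⁿ-mono 1≤b a n≤n' = go (≤⇒≤′ n≤n')
    where
    go : ∀ {n n'} → n ≤′ n' → μⁿ n a ∣ˡ μⁿ n' a
    go ≤′-refl                      = ∣ˡ-refl
    go {n' = suc n'} (≤′-step n≤n') = ∣ˡ-trans (go n≤n') (μⁿ-∣ˡ-suc 1≤b n' a)

  tm≡nth-μⁿ : 2 ≤ b → ∀ n a {i} → i < length (μⁿ n a) → tm b σ a i ≡ nth (μⁿ n a) i a
  tm≡nth-μⁿ 2≤b n a {i} i<n = begin
    nth (μⁿ (suc i) a) i a         ≡⟨ nth-∣ˡ a (μⁿ-mono 1≤b a (m≤n⊔m n (suc i))) i<b^[1+i] ⟩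
    nth (μⁿ (n ⊔ suc i) a) i a     ≡⟨ nth-∣ˡ a (μⁿ-mono 1≤b a (m≤m⊔n n (suc i))) i<n ⟨
    nth (μⁿ n a) i a               ∎
    where
    open ≡-Reasoning
    1≤b : 1 ≤ b
    1≤b = ≤-trans (s≤s z≤n) 2≤b
    i<b^[1+i] : i < length (μⁿ (suc i) a)
    i<b^[1+i] = subst (i <_) (sym (length-μⁿ (suc i) a)) (<-trans (n<1+n i) (n<b^n 2≤b (suc i)))

  tm-digit : 2 ≤ b → ∀ a X {j} → j < b → tm b σ a (X * b + j) ≡ iter σ j (tm b σ a X)
  tm-digit 2≤b a X {j} j<b = trans (tm≡nth-μⁿ 2≤b (suc (suc X)) a position<) (nth-μ* (μⁿ (suc X) a) X a X<n j<b)
    where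
    X<n : X < length (μⁿ (suc X) a)
    X<n = subst (X <_) (sym (length-μⁿ (suc X) a)) (<-trans (n<1+n X) (n<b^n 2≤b (suc X)))
    position< : X * b + j < length (μⁿ (suc (suc X)) a)
    position< = subst (_ <_) (sym (length-μ* (μⁿ (suc X) a))) (X*b+j<N*b X<n j<b)

module _ {m : ℕ} {σ : Fin m → Fin m} (cyc : IsCyclicPerm m σ) where

  private
    orbit : ∀ x y → ∃ λ k → iter σ k x ≡ y
    orbit = proj₂ (proj₂ cyc)

  fixed-point⇒identity : ∀ {d y} → iter σ d y ≡ y → ∀ z → iter σ d z ≡ z
  fixed-point⇒identity {d} {y} σᵈy≡y z with orbit y z
  ... | k , refl = begin
    iter σ d (iter σ k y) ≡⟨ iter-comm σ d k y ⟩
    iter σ k (iter σ d y) ≡⟨ cong (iter σ k) σᵈy≡y ⟩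
    iter σ k y            ∎
    where open ≡-Reasoning

  -- If σ^(1+d) = id, every letter is σ^i x₀ with i < 1+d, so m ≤ 1+d by pigeonhole.
  module _ {d} (σ¹⁺ᵈ≗id : ∀ z → iter σ (suc d) z ≡ z) (1+d<m : suc d < m) where
    private
      x₀ : Fin m
      x₀ = fromℕ< (≤-trans (s≤s z≤n) 1+d<m)

      exponent : Fin m → Fin (suc d)
      exponent z = fromℕ< (m%n<n (proj₁ (orbit x₀ z)) (suc d))

      power : Fin (suc d) → Fin m
      power i = iter σ (toℕ i) x₀

      power-exponent : ∀ z → power (exponent z) ≡ z
      power-exponent z = begin
        iter σ (toℕ (exponent z)) x₀                        ≡⟨ cong (λ e → iter σ e x₀) (Fin.toℕ-fromℕ< (m%n<n k (suc d))) ⟩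
        iter σ (k % suc d) x₀                               ≡⟨ cong (iter σ (k % suc d)) (iter-*-identity σ σ¹⁺ᵈ≗id (k / suc d) x₀) ⟨
        iter σ (k % suc d) (iter σ (k / suc d * suc d) x₀)  ≡⟨ iter-+ σ (k % suc d) _ x₀ ⟨
        iter σ (k % suc d + k / suc d * suc d) x₀           ≡⟨ cong (λ e → iter σ e x₀) (m≡m%n+[m/n]*n k (suc d)) ⟨
        iter σ k x₀                                         ≡⟨ proj₂ (orbit x₀ z) ⟩
        z                                                   ∎
        where
        open ≡-Reasoning
        k : ℕ
        k = proj₁ (orbit x₀ z)

    short-cycle-impossible : ⊥
    short-cycle-impossible with Fin.pigeonhole 1+d<m exponent
    ... | i , j , i<j , same =
      Fin.<⇒≢ i<j (trans (sym (power-exponent i)) (trans (cong power same) (power-exponent j)))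

  identity-iterate⇒m≤ : ∀ d → (∀ z → iter σ (suc d) z ≡ z) → m ≤ suc d
  identity-iterate⇒m≤ d σ¹⁺ᵈ≗id = ≮⇒≥ (short-cycle-impossible σ¹⁺ᵈ≗id)

record PeriodicRun {A : Set} (t : ℕ → A) (ℓ p n : ℕ) : Set where
  constructor periodic-run
  field
    repeats : ∀ k → k < n → t (p + k + ℓ) ≡ t (p + k)

open PeriodicRun

module PeriodicRunProperties {A : Set} {t : ℕ → A} {ℓ : ℕ} where

  run-first : ∀ {p n} → PeriodicRun t ℓ p (suc n) → t (p + ℓ) ≡ t p
  run-first {p} run = subst (λ x → t (x + ℓ) ≡ t x) (+-identityʳ p) (repeats run 0 (s≤s z≤n))

  run-shorten : ∀ {p n n'} → n ≤ n' → PeriodicRun t ℓ p n' → PeriodicRun t ℓ p n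
  run-shorten n≤n' run = periodic-run λ k k<n → repeats run k (<-≤-trans k<n n≤n')

  run-drop : ∀ {p p'} d {n} → p + d ≡ p' → PeriodicRun t ℓ p (d + n) → PeriodicRun t ℓ p' n
  run-drop {p} d refl run = periodic-run λ k k<n →
    subst (λ x → t (x + ℓ) ≡ t x) (sym (+-assoc p d k)) (repeats run (d + k) (+-monoʳ-< d k<n))

  run-length< : ∀ {p n N} → ¬ PeriodicRun t ℓ p N → PeriodicRun t ℓ p n → n < N
  run-length< {n = n} {N} ¬run run with n <? N
  ... | yes n<N = n<N
  ... | no  n≮N = contradiction (run-shorten (≮⇒≥ n≮N) run) ¬run

module _ {A : Set} {w u : List A} (u∣ˡw : u ∣ˡ w) where

  private
    unfold : ∀ k → concat (replicate (suc k) w) ++ u ≡ w ++ (concat (replicate k w) ++ u)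
    unfold k = ++-assoc w (concat (replicate k w)) u

  replicate++-∣ˡ : ∀ k → (concat (replicate k w) ++ u) ∣ˡ (w ++ (concat (replicate k w) ++ u))
  replicate++-∣ˡ zero    = x∣ˡy⇒x∣ˡyz u u∣ˡw
  replicate++-∣ˡ (suc k) =
    subst₂ _∣ˡ_ (sym (unfold k)) (cong (w ++_) (sym (unfold k))) (x∣ˡy⇒zx∣ˡzy w (replicate++-∣ˡ k))

  nth-replicate++-periodic : ∀ k j d → j + length w < length (concat (replicate k w) ++ u) →
    nth (concat (replicate k w) ++ u) (j + length w) d ≡ nth (concat (replicate k w) ++ u) j d
  nth-replicate++-periodic zero j d j+|w|<|u| =
    contradiction (≤-trans (length-∣ˡ u∣ˡw) (m≤n+m (length w) j)) (<⇒≱ j+|w|<|u|)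
  nth-replicate++-periodic (suc k) j d j+|w|<n = begin
    nth Wᵏ⁺¹ (j + length w) d        ≡⟨ cong (λ i → nth Wᵏ⁺¹ i d) (+-comm j (length w)) ⟩
    nth Wᵏ⁺¹ (length w + j) d        ≡⟨ cong (λ xs → nth xs (length w + j) d) (unfold k) ⟩
    nth (w ++ Wᵏ) (length w + j) d   ≡⟨ nth-++ʳ w Wᵏ j d ⟩
    nth Wᵏ j d                       ≡⟨ nth-∣ˡ d (replicate++-∣ˡ k) j<|Wᵏ| ⟩
    nth (w ++ Wᵏ) j d                ≡⟨ cong (λ xs → nth xs j d) (unfold k) ⟨
    nth Wᵏ⁺¹ j d                     ∎
    where
    open ≡-Reasoning
    Wᵏ Wᵏ⁺¹ : List A
    Wᵏ = concat (replicate k w) ++ u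
    Wᵏ⁺¹ = concat (replicate (suc k) w) ++ u
    j<|Wᵏ| : j < length Wᵏ
    j<|Wᵏ| = +-cancelˡ-< (length w) j (length Wᵏ)
      (subst₂ _<_ (+-comm j (length w)) (trans (cong length (unfold k)) (length-++ w)) j+|w|<n)

module _ {A : Set} (w : List A) .{{_ : NonZero (length w)}} where

  length-pow : ∀ L → length (pow w L) ≡ L
  length-pow L = begin
    length (concat (replicate (L / ℓ) w) ++ take (L % ℓ) w)   ≡⟨ length-++ (concat (replicate (L / ℓ) w)) ⟩
    length (concat (replicate (L / ℓ) w)) + length (take (L % ℓ) w)
      ≡⟨ cong₂ _+_ (length-concat-replicate (L / ℓ) w) (trans (length-take (L % ℓ) w) (m≤n⇒m⊓n≡m (m%n≤n L ℓ))) ⟩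
    L / ℓ * ℓ + L % ℓ                                          ≡⟨ +-comm (L / ℓ * ℓ) (L % ℓ) ⟩
    L % ℓ + L / ℓ * ℓ                                          ≡⟨ m≡m%n+[m/n]*n L ℓ ⟨
    L                                                          ∎
    where
    open ≡-Reasoning
    ℓ : ℕ
    ℓ = length w

  nth-pow-periodic : ∀ L j d → j + length w < L → nth (pow w L) (j + length w) d ≡ nth (pow w L) j d
  nth-pow-periodic L j d j+|w|<L = nth-replicate++-periodic (drop c w , take++drop≡id c w) (L / length w) j d
    (subst (j + length w <_) (sym (length-pow L)) j+|w|<L)
    where c = L % length w

  pow-occurrence⇒run : ∀ {t : ℕ → A} {L p} →
    (∀ j (j<n : j < length (pow w L)) → t (p + j) ≡ lookup (pow w L) (fromℕ< j<n)) →
    ∀ n → n + length w ≤ L → PeriodicRun t (length w) p n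
  pow-occurrence⇒run {t} {L} {p} occurrence n n+ℓ≤L =
    periodic-run λ k k<n → repeats-at k (<-≤-trans (+-monoˡ-< (length w) k<n) n+ℓ≤L)
    where
    ℓ : ℕ
    ℓ = length w
    repeats-at : ∀ k → k + ℓ < L → t (p + k + ℓ) ≡ t (p + k)
    repeats-at k k+ℓ<L = begin
      t (p + k + ℓ)                            ≡⟨ cong t (+-assoc p k ℓ) ⟩
      t (p + (k + ℓ))                          ≡⟨ occurrence (k + ℓ) k+ℓ<|pow| ⟩
      lookup (pow w L) (fromℕ< k+ℓ<|pow|)      ≡⟨ lookup-fromℕ<≡nth (pow w L) (t p) k+ℓ<|pow| ⟩
      nth (pow w L) (k + ℓ) (t p)              ≡⟨ nth-pow-periodic L k (t p) k+ℓ<L ⟩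
      nth (pow w L) k (t p)                    ≡⟨ lookup-fromℕ<≡nth (pow w L) (t p) k<|pow| ⟨
      lookup (pow w L) (fromℕ< k<|pow|)        ≡⟨ occurrence k k<|pow| ⟨
      t (p + k)                                ∎
      where
      open ≡-Reasoning
      k+ℓ<|pow| : k + ℓ < length (pow w L)
      k+ℓ<|pow| = subst (k + ℓ <_) (sym (length-pow L)) k+ℓ<L
      k<|pow| : k < length (pow w L)
      k<|pow| = <-≤-trans (m≤m+n (suc k) ℓ) k+ℓ<|pow|

module AperiodicTM {m : ℕ} (b₁ : ℕ) (1≤b₁ : 1 ≤ b₁) {σ : Fin m → Fin m} (cyc : IsCyclicPerm m σ)
                   {ᾱ : Fin m} (aper : Aperiodic (tm (suc b₁) σ ᾱ)) where

  b : ℕ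
  b = suc b₁

  t : ℕ → Fin m
  t = tm b σ ᾱ

  σ-injective : ∀ {x y} → σ x ≡ σ y → x ≡ y
  σ-injective = proj₁ cyc _ _

  digit : ∀ X {j} → j < b → t (X * b + j) ≡ iter σ j (t X)
  digit = tm-digit b σ (s≤s 1≤b₁) ᾱ

  t-suc-within-block : ∀ X {j} → suc j < b → t (suc (X * b + j)) ≡ σ (t (X * b + j))
  t-suc-within-block X {j} 1+j<b = begin
    t (suc (X * b + j))   ≡⟨ cong t (+-suc (X * b) j) ⟨
    t (X * b + suc j)     ≡⟨ digit X 1+j<b ⟩
    σ (iter σ j (t X))    ≡⟨ cong σ (digit X (<-trans (n<1+n j) 1+j<b)) ⟨
    σ (t (X * b + j))     ∎
    where open ≡-Reasoning

  module _ (σᵇ⁻¹≗id : ∀ y → iter σ b₁ y ≡ y) where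

    t-suc : ∀ n → t (suc n) ≡ σ (t n)
    t-suc = <-rec _ step
      where
      step : ∀ n → (∀ {k} → k < n → t (suc k) ≡ σ (t k)) → t (suc n) ≡ σ (t n)
      step n ih with quotient-remainder n b
      ... | X , j , j<b , refl with suc j <? b
      ...   | yes 1+j<b = t-suc-within-block X 1+j<b
      ...   | no  1+j≮b with ≤-antisym (s≤s⁻¹ j<b) (s≤s⁻¹ (≮⇒≥ 1+j≮b))
      ...     | refl = begin
        t (suc (X * b + b₁))   ≡⟨ cong t (block-end X b₁) ⟩
        t (suc X * b + 0)      ≡⟨ digit (suc X) (s≤s z≤n) ⟩
        t (suc X)              ≡⟨ ih (≤-<-trans (m≤m*n X b) (m<m+n (X * b) 1≤b₁)) ⟩
        σ (t X)                ≡⟨ cong σ (σᵇ⁻¹≗id (t X)) ⟨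
        σ (iter σ b₁ (t X))    ≡⟨ cong σ (digit X j<b) ⟨
        σ (t (X * b + b₁))     ∎
        where
        open ≡-Reasoning
        block-end : ∀ X b₁ → suc (X * suc b₁ + b₁) ≡ suc X * suc b₁ + 0
        block-end = solve-∀

    t-shift : ∀ n k → t (n + k) ≡ iter σ k (t n)
    t-shift n zero    = cong t (+-identityʳ n)
    t-shift n (suc k) = trans (cong t (+-suc n k)) (trans (t-suc (n + k)) (cong σ (t-shift n k)))

    t-periodic : UltPeriodic t
    t-periodic = b₁ , 0 , 1≤b₁ , λ n _ → trans (t-shift n b₁) (σᵇ⁻¹≗id (t n))

  σᵇ-step⇒b∣suc : ∀ x → t (suc x) ≡ iter σ b (t x) → b ∣ suc x
  σᵇ-step⇒b∣suc x σᵇ-step with quotient-remainder x b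
  ... | X , j , j<b , refl with suc j <? b
  ...   | yes 1+j<b = contradiction (t-periodic (fixed-point⇒identity cyc {b₁} (sym σᵇ⁻¹-fixes))) aper
    where
    σᵇ⁻¹-fixes : t (X * b + j) ≡ iter σ b₁ (t (X * b + j))
    σᵇ⁻¹-fixes = σ-injective (trans (sym (t-suc-within-block X 1+j<b)) σᵇ-step)
  ...   | no  1+j≮b with ≤-antisym (s≤s⁻¹ j<b) (s≤s⁻¹ (≮⇒≥ 1+j≮b))
  ...     | refl = divides (suc X) (cong suc (+-comm (X * b) b₁))

  ¬consecutive-multiples : ∀ {n} → b ∣ n → b ∣ suc n → ⊥
  ¬consecutive-multiples b∣n b∣1+n = <⇒≢ (s≤s 1≤b₁) (sym (∣n∧∣1+n⇒≡1 b∣n b∣1+n))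

module Repetitions {m : ℕ} (q r' s' : ℕ) {σ : Fin m → Fin m} (cyc : IsCyclicPerm m σ)
                   {ᾱ : Fin m} (aper : Aperiodic (tm (suc r' + suc s') σ ᾱ)) where

  r s : ℕ
  r = suc r'
  s = suc s'

  open AperiodicTM (r' + s) (≤-trans (s≤s z≤n) (m≤n+m s r')) cyc aper

  ℓ : ℕ
  ℓ = q * b + r

  Run : ℕ → ℕ → Set
  Run = PeriodicRun t ℓ

  open PeriodicRunProperties {t = t} {ℓ = ℓ}

  HeadRelation TailRelation : ℕ → Set
  HeadRelation B = iter σ r (t (B + q)) ≡ t B
  TailRelation B = t (suc (B + q)) ≡ iter σ s (t B)

  private
    0<r : 0 < r
    0<r = s≤s z≤n

    0<s : 0 < s
    0<s = s≤s z≤n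

  head-relation : ∀ B {j} → j < s → t (B * b + j + ℓ) ≡ t (B * b + j) → HeadRelation B
  head-relation B {j} j<s period = iter-injective σ σ-injective j (begin
    iter σ j (iter σ r (t (B + q)))   ≡⟨ iter-+ σ j r _ ⟨
    iter σ (j + r) (t (B + q))        ≡⟨ digit (B + q) (subst (j + r <_) (+-comm s r) (+-monoˡ-< r j<s)) ⟨
    t ((B + q) * b + (j + r))         ≡⟨ cong t (shift B b j q r) ⟨
    t (B * b + j + ℓ)                 ≡⟨ period ⟩
    t (B * b + j)                     ≡⟨ digit B (<-≤-trans j<s (m≤n+m s r)) ⟩
    iter σ j (t B)                    ∎)
    where
    open ≡-Reasoning
    shift : ∀ B b j q r → B * b + j + (q * b + r) ≡ (B + q) * b + (j + r)
    shift = solve-∀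

  tail-relation : ∀ B {i} → i < r → t (B * b + (s + i) + ℓ) ≡ t (B * b + (s + i)) → TailRelation B
  tail-relation B {i} i<r period = iter-injective σ σ-injective i (begin
    iter σ i (t (suc (B + q)))        ≡⟨ digit (suc (B + q)) (<-≤-trans i<r (m≤m+n r s)) ⟨
    t (suc (B + q) * b + i)           ≡⟨ cong t (shift B q r s i) ⟩
    t (B * b + (s + i) + ℓ)           ≡⟨ period ⟩
    t (B * b + (s + i))               ≡⟨ digit B (subst (s + i <_) (+-comm s r) (+-monoʳ-< s i<r)) ⟩
    iter σ (s + i) (t B)              ≡⟨ cong (λ e → iter σ e (t B)) (+-comm s i) ⟩
    iter σ (i + s) (t B)              ≡⟨ iter-+ σ i s (t B) ⟩
    iter σ i (iter σ s (t B))         ∎)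
    where
    open ≡-Reasoning
    shift : ∀ B q r s i → suc (B + q) * (r + s) + i ≡ B * (r + s) + (s + i) + (q * (r + s) + r)
    shift = solve-∀

  head-tail⇒b∣ : ∀ B → HeadRelation B → TailRelation B → b ∣ suc (B + q)
  head-tail⇒b∣ B head tail = σᵇ-step⇒b∣suc (B + q) (begin
    t (suc (B + q))                   ≡⟨ tail ⟩
    iter σ s (t B)                    ≡⟨ cong (iter σ s) head ⟨
    iter σ s (iter σ r (t (B + q)))   ≡⟨ iter-+ σ s r _ ⟨
    iter σ (s + r) (t (B + q))        ≡⟨ cong (λ e → iter σ e (t (B + q))) (+-comm s r) ⟩
    iter σ b (t (B + q))              ∎)
    where open ≡-Reasoning

  tail-head⇒b∣ : ∀ B → TailRelation B → HeadRelation (suc B) → b ∣ suc B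
  tail-head⇒b∣ B tail head = σᵇ-step⇒b∣suc B (begin
    t (suc B)                         ≡⟨ head ⟨
    iter σ r (t (suc (B + q)))        ≡⟨ cong (iter σ r) tail ⟩
    iter σ r (iter σ s (t B))         ≡⟨ iter-+ σ r s (t B) ⟨
    iter σ b (t B)                    ∎)
    where open ≡-Reasoning

  leave-head : ∀ B {j n} → j < s → Run (B * b + j) (s + n) → Run (B * b + (s + 0)) n
  leave-head B {j} {n} j<s run with m≤n⇒∃[o]m+o≡n (<⇒≤ j<s)
  ... | d , j+d≡s = run-drop d position (run-shorten {B * b + j} (+-monoˡ-≤ n d≤s) run)
    where
    d≤s : d ≤ s
    d≤s = subst (d ≤_) j+d≡s (m≤n+m d j)
    position : B * b + j + d ≡ B * b + (s + 0)
    position = trans (+-assoc (B * b) j d) (cong (B * b +_) (trans j+d≡s (sym (+-identityʳ s))))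

  leave-tail : ∀ B {i n} → i < r → Run (B * b + (s + i)) (r + n) → Run (suc B * b + 0) n
  leave-tail B {i} {n} i<r run with m≤n⇒∃[o]m+o≡n i<r
  ... | e , 1+i+e≡r = run-drop (suc e) position (run-shorten {B * b + (s + i)} (+-monoˡ-≤ n 1+e≤r) run)
    where
    1+e≤r : suc e ≤ r
    1+e≤r = subst (suc e ≤_) 1+i+e≡r (s≤s (m≤n+m e i))
    block-start : ∀ B i e s → B * (suc i + e + s) + (s + i) + suc e ≡ suc B * (suc i + e + s) + 0
    block-start = solve-∀
    position : B * b + (s + i) + suc e ≡ suc B * b + 0
    position = subst (λ r → B * (r + s) + (s + i) + suc e ≡ suc B * (r + s) + 0) 1+i+e≡r (block-start B i e s)

  ¬run-THTH : ∀ B {i} → i < r → ¬ Run (B * b + (s + i)) (r + (s + (r + 1)))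
  ¬run-THTH B i<r run = ¬consecutive-multiples (tail-head⇒b∣ B T₀ H₁) (tail-head⇒b∣ (suc B) T₁ H₂)
    where
    T₀ : TailRelation B
    T₀ = tail-relation B i<r (run-first run)
    run₁ : Run (suc B * b + 0) (s + (r + 1))
    run₁ = leave-tail B i<r run
    H₁ : HeadRelation (suc B)
    H₁ = head-relation (suc B) 0<s (run-first run₁)
    run₂ : Run (suc B * b + (s + 0)) (r + 1)
    run₂ = leave-head (suc B) 0<s run₁
    T₁ : TailRelation (suc B)
    T₁ = tail-relation (suc B) 0<r (run-first run₂)
    run₃ : Run (suc (suc B) * b + 0) 1
    run₃ = leave-tail (suc B) 0<r run₂
    H₂ : HeadRelation (suc (suc B))
    H₂ = head-relation (suc (suc B)) 0<s (run-first run₃)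

  ¬run-HTH : q ≡ 1 → ∀ B {j} → j < s → ¬ Run (B * b + j) (s + (r + 1))
  ¬run-HTH refl B j<s run =
    ¬consecutive-multiples (tail-head⇒b∣ B T₀ H₁) (subst (λ x → b ∣ suc x) (+-comm B 1) (head-tail⇒b∣ B H₀ T₀))
    where
    H₀ : HeadRelation B
    H₀ = head-relation B j<s (run-first run)
    run₁ : Run (B * b + (s + 0)) (r + 1)
    run₁ = leave-head B j<s run
    T₀ : TailRelation B
    T₀ = tail-relation B 0<r (run-first run₁)
    run₂ : Run (suc B * b + 0) 1
    run₂ = leave-tail B 0<r run₁
    H₁ : HeadRelation (suc B)
    H₁ = head-relation (suc B) 0<s (run-first run₂)

  ¬run-THT : q ≡ 0 → ∀ B {i} → i < r → ¬ Run (B * b + (s + i)) (r + (s + 1))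
  ¬run-THT refl B i<r run =
    ¬consecutive-multiples (tail-head⇒b∣ B T₀ H₁)
      (subst (λ x → b ∣ suc x) (+-identityʳ (suc B)) (head-tail⇒b∣ (suc B) H₁ T₁))
    where
    T₀ : TailRelation B
    T₀ = tail-relation B i<r (run-first run)
    run₁ : Run (suc B * b + 0) (s + 1)
    run₁ = leave-tail B i<r run
    H₁ : HeadRelation (suc B)
    H₁ = head-relation (suc B) 0<s (run-first run₁)
    run₂ : Run (suc B * b + (s + 0)) 1
    run₂ = leave-head (suc B) 0<s run₁
    T₁ : TailRelation (suc B)
    T₁ = tail-relation (suc B) 0<r (run-first run₂)

  ¬run-H : q ≡ 0 → r < m → ∀ B {j n} → j < s → ¬ Run (B * b + j) (suc n)
  ¬run-H refl r<m B j<s run = <⇒≱ r<m (identity-iterate⇒m≤ cyc r' (fixed-point⇒identity cyc {r} σʳ-fixes))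
    where
    σʳ-fixes : iter σ r (t B) ≡ t B
    σʳ-fixes = subst (λ x → iter σ r (t x) ≡ t B) (+-identityʳ B) (head-relation B j<s (run-first run))

  ¬run-anywhere : ∀ {N} → (∀ B {j} → j < s → ¬ Run (B * b + j) N) →
                  (∀ B {i} → i < r → ¬ Run (B * b + (s + i)) N) → ∀ p → ¬ Run p N
  ¬run-anywhere ¬head ¬tail p with quotient-remainder p b
  ... | B , j , j<b , refl with j <? s
  ...   | yes j<s = ¬head B j<s
  ...   | no  j≮s with m≤n⇒∃[o]m+o≡n (≮⇒≥ j≮s)
  ...     | i , refl = ¬tail B (+-cancelˡ-< s i r (subst (s + i <_) (+-comm r s) j<b))

  run-bound-2≤q : 2 ≤ q → ∀ {p n} → Run p n → n ≤ ℓ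
  run-bound-2≤q 2≤q {p} {n} run = begin
    n      ≤⟨ m<1+n⇒m≤n (subst (n <_) (length-2b+1 r' s') (run-length< (¬run p) run)) ⟩
    2 * b  ≤⟨ *-monoˡ-≤ b 2≤q ⟩
    q * b  ≤⟨ m≤m+n (q * b) r ⟩
    ℓ      ∎
    where
    open ≤-Reasoning
    length-2b+1 : ∀ r' s' → suc s' + (suc r' + (suc s' + (suc r' + 1))) ≡ suc (2 * (suc r' + suc s'))
    length-2b+1 = solve-∀
    ¬run : ∀ p → ¬ Run p (s + (r + (s + (r + 1))))
    ¬run = ¬run-anywhere (λ B j<s → ¬run-THTH B 0<r ∘ leave-head B j<s)
                         (λ B i<r → ¬run-THTH B i<r ∘ run-shorten (m≤n+m _ s))

  run-bound-q≡1 : q ≡ 1 → ∀ {p n} → Run p n → n ≤ ℓ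
  run-bound-q≡1 refl {p} {n} run = m<1+n⇒m≤n (subst (n <_) (length-ℓ+1 r' s') (run-length< (¬run p) run))
    where
    length-ℓ+1 : ∀ r' s' → suc r' + (suc s' + (suc r' + 1)) ≡ suc (1 * (suc r' + suc s') + suc r')
    length-ℓ+1 = solve-∀
    ¬run : ∀ p → ¬ Run p (r + (s + (r + 1)))
    ¬run = ¬run-anywhere (λ B j<s → ¬run-HTH refl B j<s ∘ run-shorten (m≤n+m _ r))
                         (λ B i<r → ¬run-HTH refl (suc B) 0<s ∘ leave-tail B i<r)

  run-bound-q≡0 : q ≡ 0 → ∀ {p n} → Run p n → n + ℓ ≤ 2 * b
  run-bound-q≡0 refl {p} {n} run = begin
    n + r          ≤⟨ +-monoˡ-≤ r (m<1+n⇒m≤n (subst (n <_) (length-b+s+1 r' s') (run-length< (¬run p) run))) ⟩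
    b + s + r      ≡⟨ 2b r' s' ⟩
    2 * b          ∎
    where
    open ≤-Reasoning
    length-b+s+1 : ∀ r' s' → suc s' + (suc r' + (suc s' + 1)) ≡ suc (suc r' + suc s' + suc s')
    length-b+s+1 = solve-∀
    2b : ∀ r' s' → suc r' + suc s' + suc s' + suc r' ≡ 2 * (suc r' + suc s')
    2b = solve-∀
    ¬run : ∀ p → ¬ Run p (s + (r + (s + 1)))
    ¬run = ¬run-anywhere (λ B j<s → ¬run-THT refl B 0<r ∘ leave-head B j<s)
                         (λ B i<r → ¬run-THT refl B i<r ∘ run-shorten (m≤n+m _ s))

  run-bound-q≡0-r<m : q ≡ 0 → r < m → ∀ {p n} → Run p n → n ≤ ℓ
  run-bound-q≡0-r<m refl r<m {p} {n} run = m<1+n⇒m≤n (subst (n <_) (+-comm r 1) (run-length< (¬run p) run))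
    where
    ¬run : ∀ p → ¬ Run p (r + 1)
    ¬run = ¬run-anywhere (λ B j<s → ¬run-H refl r<m B j<s)
                         (λ B i<r → ¬run-H refl r<m (suc B) 0<s ∘ leave-tail B i<r)

nondivisible-decomposition : ∀ b ℓ .{{_ : NonZero b}} → ¬ b ∣ ℓ →
  ∃₂ λ q r' → ∃ λ s' → b ≡ suc r' + suc s' × ℓ ≡ q * b + suc r'
nondivisible-decomposition b ℓ b∤ℓ with quotient-remainder ℓ b
... | q , zero , _ , ℓ≡ = contradiction (divides q (trans ℓ≡ (+-identityʳ (q * b)))) b∤ℓ
... | q , suc r' , 1+r'<b , ℓ≡ with m≤n⇒∃[o]m+o≡n 1+r'<b
...   | s' , 2+r'+s'≡b = q , r' , s' , trans (sym 2+r'+s'≡b) (sym (+-suc (suc r') s')) , ℓ≡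

run-bound : ∀ {m} b .{{_ : NonZero b}} {σ : Fin m → Fin m} → IsCyclicPerm m σ → ∀ {ᾱ} → Aperiodic (tm b σ ᾱ) →
  ∀ {ℓ} → ¬ b ∣ ℓ → ∀ {p n} → PeriodicRun (tm b σ ᾱ) ℓ p n → n ≤ ℓ ⊎ (n + ℓ ≤ 2 * b × m ≤ ℓ)
run-bound {m} b cyc aper {ℓ} b∤ℓ run with nondivisible-decomposition b ℓ b∤ℓ
... | zero , r' , s' , refl , refl with suc r' <? m
...   | yes r<m = inj₁ (Repetitions.run-bound-q≡0-r<m 0 r' s' cyc aper refl r<m run)
...   | no  r≮m = inj₂ (Repetitions.run-bound-q≡0 0 r' s' cyc aper refl run , ≮⇒≥ r≮m)
run-bound b cyc aper b∤ℓ run | suc zero , r' , s' , refl , refl =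
  inj₁ (Repetitions.run-bound-q≡1 1 r' s' cyc aper refl run)
run-bound b cyc aper b∤ℓ run | suc (suc q) , r' , s' , refl , refl =
  inj₁ (Repetitions.run-bound-2≤q (suc (suc q)) r' s' cyc aper (s≤s (s≤s z≤n)) run)

IndexBound : ℕ → ℕ → ℕ → ℕ → Set
IndexBound b m ℓ L = (m < b → L * m ≤ 2 * b * ℓ) × (b ≤ m → L ≤ 2 * ℓ)

index-bound-≤2ℓ : ∀ b m ℓ L → L ≤ 2 * ℓ → IndexBound b m ℓ L
index-bound-≤2ℓ b m ℓ L L≤2ℓ = L*m≤2bℓ , λ _ → L≤2ℓ
  where
  open ≤-Reasoning
  L*m≤2bℓ : m < b → L * m ≤ 2 * b * ℓ
  L*m≤2bℓ m<b = begin
    L * m       ≤⟨ *-monoˡ-≤ m L≤2ℓ ⟩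
    2 * ℓ * m   ≤⟨ *-monoʳ-≤ (2 * ℓ) (<⇒≤ m<b) ⟩
    2 * ℓ * b   ≡⟨ swap 2 ℓ b ⟩
    2 * b * ℓ   ∎
    where
    swap : ∀ x y z → x * y * z ≡ x * z * y
    swap = solve-∀

index-bound-≤2b : ∀ b m ℓ L → L ≤ 2 * b → m ≤ ℓ → IndexBound b m ℓ L
index-bound-≤2b b m ℓ L L≤2b m≤ℓ =
  (λ _ → ≤-trans (*-monoˡ-≤ m L≤2b) (*-monoʳ-≤ (2 * b) m≤ℓ)) ,
  (λ b≤m → ≤-trans L≤2b (*-monoʳ-≤ 2 (≤-trans b≤m m≤ℓ)))

index-bound : ∀ b m ℓ L → (∀ n → n + ℓ ≤ L → n ≤ ℓ ⊎ (n + ℓ ≤ 2 * b × m ≤ ℓ)) → IndexBound b m ℓ L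
index-bound b m ℓ L bound with ℓ ≤? L
... | no  ℓ≰L = index-bound-≤2ℓ b m ℓ L (≤-trans (<⇒≤ (≰⇒> ℓ≰L)) (m≤m+n ℓ (ℓ + 0)))
... | yes ℓ≤L with bound (L ∸ ℓ) (≤-reflexive (m∸n+n≡m ℓ≤L))
...   | inj₁ n≤ℓ = index-bound-≤2ℓ b m ℓ L
        (subst (_≤ 2 * ℓ) (m∸n+n≡m ℓ≤L) (≤-trans (+-monoˡ-≤ ℓ n≤ℓ) (≤-reflexive ℓ+ℓ≡2ℓ)))
      where
      ℓ+ℓ≡2ℓ : ℓ + ℓ ≡ 2 * ℓ
      ℓ+ℓ≡2ℓ = cong (ℓ +_) (sym (+-identityʳ ℓ))
...   | inj₂ (n+ℓ≤2b , m≤ℓ) = index-bound-≤2b b m ℓ L (subst (_≤ 2 * b) (m∸n+n≡m ℓ≤L) n+ℓ≤2b) m≤ℓ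

lemma4p3 : (b m : ℕ) → 2 ≤ b → 1 ≤ m →
    (σ : Fin m → Fin m) → IsCyclicPerm m σ → (ᾱ : Fin m) →
    Aperiodic (tm b σ ᾱ) →
    (w : List (Fin m)) → .{{_ : NonZero (length w)}} →
    Factor w (tm b σ ᾱ) → ¬ (b ∣ length w) →
    (L : ℕ) → 1 ≤ L → Factor (pow w L) (tm b σ ᾱ) →
    (m < b → L * m ≤ 2 * b * length w) × (b ≤ m → L ≤ 2 * length w)
lemma4p3 b m 2≤b _ σ cyc ᾱ aper w _ b∤|w| L _ (p , occurrence) =
  index-bound b m (length w) L λ n n+|w|≤L →
    run-bound b {{>-nonZero (<-≤-trans z<s 2≤b)}} cyc aper b∤|w|
      (pow-occurrence⇒run w {p = p} occurrence n n+|w|≤L)
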